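{- Let $u,v\in P$ with $u<v$. Then the relations $<$ and $\mathrm{Low}$ are primitive positive definable in $(P;\mathrm{Betw},\perp,u,v)$.
   Context: $\mathbb{P}=(P;\leq)$ is the random partial order (the unique countable homogeneous partial order embedding all finite partial orders); $x<y$ means $x\leq y\wedge x\neq y$, $x\perp y$ incomparability, $z\perp xy$ means $z\perp x\wedge z\perp y$. $\mathrm{Betw}(x,y,z):=(x<y\wedge y<z)\vee(z<y\wedge y<x)$; $\mathrm{Low}(x,y,z):=(x<y\wedge z\perp xy)\vee(x<z\wedge y\perp xz)$. $(P;\mathrm{Betw},\perp,u,v)$ is the structure with these relations and constants $u,v$. Primitive positive definable means definable by $\exists\bar y(\psi_1\wedge\dots\wedge\psi_m)$ with atomic $\psi_i$. -}

module Defs where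

open import Data.Nat using (ℕ; _+_)
open import Data.Fin using (Fin; zero; suc)
open import Data.Product using (Σ; _×_; _,_; ∃)
open import Data.Sum using (_⊎_)
open import Data.List using (List)
open import Data.List.Relation.Unary.All using (All)
open import Data.Vec.Functional using () renaming (_++_ to _++ᶠ_)
open import Relation.Nullary using (¬_)
open import Relation.Binary using (IsPartialOrder)
open import Relation.Binary.PropositionalEquality using (_≡_)
open import Function.Definitions using (Injective)

_⇔_ : Set → Set → Set
A ⇔ B = (A → B) × (B → A)

record RandomPO : Set₁ where
  field
    P      : Set
    _≤_    : P → P → Set
    isPO   : IsPartialOrder _≡_ _≤_
    countable : Σ (P → ℕ) (Injective _≡_ _≡_)
    -- homogeneous: every isomorphism between finite induced suborders
    -- (given as two tuples inducing the same order pattern) extends to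
    -- an automorphism
    homogeneous : ∀ (n : ℕ) (f g : Fin n → P) →
      (∀ i j → (f i ≤ f j) ⇔ (g i ≤ g j)) →
      Σ (P → P) λ σ → Σ (P → P) λ τ →
        (∀ x → τ (σ x) ≡ x) × (∀ x → σ (τ x) ≡ x) ×
        (∀ x y → (x ≤ y) ⇔ (σ x ≤ σ y)) × (∀ i → σ (f i) ≡ g i)
    universal : ∀ (n : ℕ) (R : Fin n → Fin n → Set) →
      IsPartialOrder _≡_ R →
      Σ (Fin n → P) λ e → Injective _≡_ _≡_ e × (∀ i j → R i j ⇔ (e i ≤ e j))

module RPO (𝕡 : RandomPO) where
  open RandomPO 𝕡 public

  _<_ : P → P → Set
  x < y = (x ≤ y) × ¬ (x ≡ y)

  _⊥_ : P → P → Set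
  x ⊥ y = ¬ (x ≤ y) × ¬ (y ≤ x)

  Betw : P → P → P → Set
  Betw x y z = ((x < y) × (y < z)) ⊎ ((z < y) × (y < x))

  Low : P → P → P → Set
  Low x y z = ((x < y) × (z ⊥ x) × (z ⊥ y)) ⊎ ((x < z) × (y ⊥ x) × (y ⊥ z))

-- Primitive positive formulas over the signature (Betw, ⊥, u, v)
-- (with equality, as usual for pp formulas).

data Term (n : ℕ) : Set where
  var : Fin n → Term n
  cu  : Term n
  cv  : Term n

data Atom (n : ℕ) : Set where
  betw : Term n → Term n → Term n → Atom n
  perp : Term n → Term n → Atom n
  eq   : Term n → Term n → Atom n

-- a pp formula with k free variables: ∃ y₁…y_m (conjunction of atoms),
-- where variables 0..k-1 are free and k..k+m-1 are the quantified ones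
record PP (k : ℕ) : Set where
  constructor pp
  field
    m     : ℕ
    atoms : List (Atom (k + m))

module PPSem (𝕡 : RandomPO) (u v : RandomPO.P 𝕡) where
  open RPO 𝕡

  evalT : ∀ {n} → (Fin n → P) → Term n → P
  evalT ρ (var i) = ρ i
  evalT ρ cu = u
  evalT ρ cv = v

  satA : ∀ {n} → (Fin n → P) → Atom n → Set
  satA ρ (betw s t r) = Betw (evalT ρ s) (evalT ρ t) (evalT ρ r)
  satA ρ (perp s t)   = evalT ρ s ⊥ evalT ρ t
  satA ρ (eq s t)     = evalT ρ s ≡ evalT ρ t

  ⟦_⟧ : ∀ {k} → PP k → (Fin k → P) → Set
  ⟦ pp m as ⟧ x = Σ (Fin m → P) λ y → All (satA (x ++ᶠ y)) as

  PPDefinable : ∀ {k} → ((Fin k → P) → Set) → Set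
  PPDefinable {k} R = Σ (PP k) λ φ → ∀ x → R x ⇔ ⟦ φ ⟧ x

module Rels (𝕡 : RandomPO) where
  open RPO 𝕡
  LtRel : (Fin 2 → P) → Set
  LtRel x = x zero < x (suc zero)
  LowRel : (Fin 3 → P) → Set
  LowRel x = Low (x zero) (x (suc zero)) (x (suc (suc zero)))

-- Betw l m r says that l m r is a monotone chain, in one of the two
-- directions; the direction is fixed once a point of the chain is compared
-- with a suitable outside point.  Starting from u < v this propagates:
--   Betw u v t ⇒ v < t;  Betw a t b, v ⊥ a ⇒ a < t;  Betw q a p, t ⊥ p ⇒ a < p;
--   Betw y p w, a ⊥ y ⇒ y < p;  Betw x y z, p ⊥ z ⇒ x < y,
-- so x < y is defined by ∃ t a b q p w z of these nine atoms, and
--   Low x y z ⇔ ∃ a b c d. y ⊥ z ∧ Betw a x b ∧ a < y ∧ b < z ∧ Betw c x d ∧ y ⊥ c ∧ z ⊥ d.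
-- Completeness needs witnesses; they come from the one-point extension
-- property of P (module Extension): by universality and homogeneity every cut
-- of a finite set is realised by a point, which yields generic points above or
-- below finite sets and density.

module Submission where

open import Defs
open import Data.Nat using (suc)
import Data.Nat.Properties as ℕ
open import Data.Fin using (Fin; zero; suc; #_; _↑ˡ_; _↑ʳ_)
open import Data.Product using (Σ; _×_; _,_; proj₁; proj₂)
open import Data.Sum using (inj₁; inj₂)
open import Data.Unit using (⊤; tt)
open import Data.Empty using (⊥-elim) renaming (⊥ to Empty)
open import Data.List using (List; []; _∷_; _++_; lookup; deduplicate)
open import Data.List.Relation.Unary.Any using (index)
import Data.List.Relation.Unary.Any as Any
open import Data.List.Relation.Unary.Any.Properties using (lookup-index)
open import Data.List.Relation.Unary.All using (All; []; _∷_)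
import Data.List.Relation.Unary.All as All
open import Data.List.Relation.Unary.All.Properties using (All¬⇒¬Any; ++⁺; ++⁻)
open import Data.List.Relation.Unary.Unique.Propositional using (Unique; _∷_)
open import Data.List.Relation.Unary.Unique.DecPropositional.Properties using (deduplicate-!)
open import Data.List.Membership.Propositional using (_∈_)
open import Data.List.Membership.Propositional.Properties using (∈-lookup; ∈-deduplicate⁺; ∈-++⁺ˡ; ∈-++⁺ʳ)
open import Data.Vec.Functional using () renaming (_∷_ to _∷ᶠ_; [] to []ᶠ; _++_ to _++ᶠ_)
open import Function using (_∘_)
open import Function.Bundles using (mk↣)
open import Relation.Nullary using (¬_)
open import Relation.Unary using (∅)
open import Relation.Nullary.Decidable using (via-injection)
open import Relation.Binary using (IsPartialOrder; DecidableEquality)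
open import Relation.Binary.PropositionalEquality using (_≡_; refl; sym; cong; subst; isEquivalence)
import Relation.Binary.Construct.NonStrictToStrict as NonStrictToStrict

⇔-sym : {A B : Set} → A ⇔ B → B ⇔ A
⇔-sym (f , g) = g , f

infixr 4 _⟨⇔⟩_
_⟨⇔⟩_ : {A B C : Set} → A ⇔ B → B ⇔ C → A ⇔ C
(f , g) ⟨⇔⟩ (h , k) = (λ a → h (f a)) , (λ c → g (k c))

≡⇒⇔ : {A B : Set} → A ≡ B → A ⇔ B
≡⇒⇔ refl = (λ a → a) , (λ a → a)

lookup-injective : {A : Set} {xs : List A} → Unique xs →
  ∀ {i j} → lookup xs i ≡ lookup xs j → i ≡ j
lookup-injective (_ ∷ _)      {zero}  {zero}  _    = refl
lookup-injective (x∉xs ∷ _)   {zero}  {suc j} same = ⊥-elim (All.lookup x∉xs (∈-lookup j) same)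
lookup-injective (x∉xs ∷ _)   {suc i} {zero}  same = ⊥-elim (All.lookup x∉xs (∈-lookup i) (sym same))
lookup-injective (_ ∷ unique) {suc i} {suc j} same = cong suc (lookup-injective unique same)

module StrictOrder (𝕡 : RandomPO) where
  open RPO 𝕡
  private
    module ≤ = IsPartialOrder isPO
    module Strict = NonStrictToStrict _≡_ _≤_

  <⇒≱ : ∀ {a b} → a < b → ¬ b ≤ a
  <⇒≱ = Strict.<⇒≱ ≤.antisym

  ≤∧≱⇒< : ∀ {a b} → a ≤ b → ¬ b ≤ a → a < b
  ≤∧≱⇒< a≤b b≰a = a≤b , λ a≡b → b≰a (≤.reflexive (sym a≡b))

  <-trans : ∀ {a b c} → a < b → b < c → a < c
  <-trans = Strict.<-trans isPO

module Extension (𝕡 : RandomPO) where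
  open RPO 𝕡
  open StrictOrder 𝕡
  private module ≤ = IsPartialOrder isPO

  _≟_ : DecidableEquality P
  _≟_ = via-injection (mk↣ {to = proj₁ countable} (proj₂ countable)) ℕ._≟_

  record Cut (D U : P → Set) : Set where
    field
      down-closed : ∀ {a b} → a ≤ b → D b → D a
      up-closed   : ∀ {a b} → a ≤ b → U a → U b
      D≤U         : ∀ {a b} → D a → U b → a ≤ b
      disjoint    : ∀ {a} → D a → ¬ U a

  -- The finite order on distinct points f, extended by a new point `zero`
  -- placed at the cut (D , U); it is a partial order.
  module OnePointExtension {n} (f : Fin n → P) (f-inj : ∀ {i j} → f i ≡ f j → i ≡ j)
                           {D U : P → Set} (cut : Cut D U) where
    open Cut cut

    R : Fin (suc n) → Fin (suc n) → Set
    R zero    zero    = ⊤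
    R zero    (suc j) = U (f j)
    R (suc i) zero    = D (f i)
    R (suc i) (suc j) = f i ≤ f j

    R-refl : ∀ {i j} → i ≡ j → R i j
    R-refl {zero}  refl = tt
    R-refl {suc i} refl = ≤.refl

    R-trans : ∀ {i j k} → R i j → R j k → R i k
    R-trans {zero}  {zero}  {_}     _ q = q
    R-trans {zero}  {suc _} {zero}  p q = ⊥-elim (disjoint q p)
    R-trans {zero}  {suc _} {suc _} p q = up-closed q p
    R-trans {suc _} {zero}  {zero}  p _ = p
    R-trans {suc _} {zero}  {suc _} p q = D≤U p q
    R-trans {suc _} {suc _} {zero}  p q = down-closed p q
    R-trans {suc _} {suc _} {suc _} p q = ≤.trans p q

    R-antisym : ∀ {i j} → R i j → R j i → i ≡ j
    R-antisym {zero}  {zero}  _ _ = refl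
    R-antisym {zero}  {suc _} p q = ⊥-elim (disjoint q p)
    R-antisym {suc _} {zero}  p q = ⊥-elim (disjoint p q)
    R-antisym {suc _} {suc _} p q = cong suc (f-inj (≤.antisym p q))

    R-isPartialOrder : IsPartialOrder _≡_ R
    R-isPartialOrder = record
      { isPreorder = record
        { isEquivalence = isEquivalence
        ; reflexive     = R-refl
        ; trans         = λ {i} {j} {k} → R-trans {i} {j} {k} }
      ; antisym = λ {i} {j} → R-antisym {i} {j} }

  -- One-point extension property for distinct points: universality embeds the
  -- extended order, and homogeneity moves the embedded copy of f back onto f,
  -- carrying the new point to a point realising the cut.
  extendDistinct : ∀ {n} (f : Fin n → P) → (∀ {i j} → f i ≡ f j → i ≡ j) →
    ∀ {D U} → Cut D U → Σ P λ z → ∀ i → ((f i ≤ z) ⇔ D (f i)) × ((z ≤ f i) ⇔ U (f i))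
  extendDistinct {n} f f-inj {D} {U} cut = z , λ i → below i , above i
    where
    open OnePointExtension f f-inj cut
    embedding = universal (suc n) R R-isPartialOrder
    e = proj₁ embedding
    e-iso : ∀ i j → R i j ⇔ (e i ≤ e j)
    e-iso = proj₂ (proj₂ embedding)
    automorphism = homogeneous n (e ∘ suc) f (λ i j → ⇔-sym (e-iso (suc i) (suc j)))
    σ = proj₁ automorphism
    σ-iso : ∀ x y → (x ≤ y) ⇔ (σ x ≤ σ y)
    σ-iso = proj₁ (proj₂ (proj₂ (proj₂ (proj₂ automorphism))))
    σ-maps : ∀ i → σ (e (suc i)) ≡ f i
    σ-maps = proj₂ (proj₂ (proj₂ (proj₂ (proj₂ automorphism))))
    z = σ (e zero)
    below : ∀ i → (f i ≤ z) ⇔ D (f i)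
    below i = ≡⇒⇔ (cong (_≤ z) (sym (σ-maps i)))
      ⟨⇔⟩ ⇔-sym (σ-iso _ _) ⟨⇔⟩ ⇔-sym (e-iso (suc i) zero)
    above : ∀ i → (z ≤ f i) ⇔ U (f i)
    above i = ≡⇒⇔ (cong (z ≤_) (sym (σ-maps i)))
      ⟨⇔⟩ ⇔-sym (σ-iso _ _) ⟨⇔⟩ ⇔-sym (e-iso zero (suc i))

  Realises : List P → (D U : P → Set) → P → Set
  Realises S D U z = ∀ {a} → a ∈ S → ((a ≤ z) ⇔ D a) × ((z ≤ a) ⇔ U a)

  realise : ∀ S {D U} → Cut D U → Σ P (Realises S D U)
  realise S {D} {U} cut = z , λ a∈S →
    let a∈S′ = ∈-deduplicate⁺ _≟_ a∈S in
    subst (λ a → ((a ≤ z) ⇔ D a) × ((z ≤ a) ⇔ U a)) (sym (lookup-index a∈S′)) (realised (index a∈S′))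
    where
    S′ = deduplicate _≟_ S
    extension = extendDistinct (lookup S′) (lookup-injective (deduplicate-! _≟_ S)) cut
    z = proj₁ extension
    realised = proj₂ extension

  record PointAbove (Ls S : List P) : Set where
    field
      point      : P
      above      : All (_< point) Ls
      not-below  : ∀ {a} → a ∈ S → ¬ point ≤ a
      only-above : ∀ {a} → a ∈ S → All (λ l → ¬ a ≤ l) Ls → ¬ a ≤ point

  record PointBelow (Gs S : List P) : Set where
    field
      point      : P
      below      : All (point <_) Gs
      not-above  : ∀ {a} → a ∈ S → ¬ a ≤ point
      only-below : ∀ {a} → a ∈ S → All (λ g → ¬ g ≤ a) Gs → ¬ point ≤ a

  DownSet UpSet : List P → P → Set
  DownSet Ls a = Any.Any (a ≤_) Ls
  UpSet   Gs a = Any.Any (_≤ a) Gs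

  pointAbove : ∀ Ls S → PointAbove Ls S
  pointAbove Ls S = record
    { point      = z
    ; above      = All.tabulate λ l∈Ls →
        let r = realised (∈-++⁺ˡ l∈Ls) in ≤∧≱⇒< (proj₂ (proj₁ r) (Any.map ≤.reflexive l∈Ls)) (proj₁ (proj₂ r))
    ; not-below  = λ a∈S → proj₁ (proj₂ (realised (∈-++⁺ʳ Ls a∈S)))
    ; only-above = λ a∈S a≰Ls a≤z → All¬⇒¬Any a≰Ls (proj₁ (proj₁ (realised (∈-++⁺ʳ Ls a∈S))) a≤z)
    }
    where
    cut : Cut (DownSet Ls) ∅
    cut = record
      { down-closed = λ a≤b → Any.map (≤.trans a≤b)
      ; up-closed   = λ _ ()
      ; D≤U         = λ _ ()
      ; disjoint    = λ _ () }
    extension = realise (Ls ++ S) cut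
    z = proj₁ extension
    realised = proj₂ extension

  pointBelow : ∀ Gs S → PointBelow Gs S
  pointBelow Gs S = record
    { point      = z
    ; below      = All.tabulate λ g∈Gs →
        let r = realised (∈-++⁺ˡ g∈Gs) in ≤∧≱⇒< (proj₂ (proj₂ r) (Any.map (≤.reflexive ∘ sym) g∈Gs)) (proj₁ (proj₁ r))
    ; not-above  = λ a∈S → proj₁ (proj₁ (realised (∈-++⁺ʳ Gs a∈S)))
    ; only-below = λ a∈S Gs≰a z≤a → All¬⇒¬Any Gs≰a (proj₁ (proj₂ (realised (∈-++⁺ʳ Gs a∈S))) z≤a)
    }
    where
    cut : Cut ∅ (UpSet Gs)
    cut = record
      { down-closed = λ _ ()
      ; up-closed   = λ a≤b → Any.map (λ g≤a → ≤.trans g≤a a≤b)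
      ; D≤U         = λ ()
      ; disjoint    = λ () }
    extension = realise (Gs ++ S) cut
    z = proj₁ extension
    realised = proj₂ extension

  dense : ∀ {x y} → x < y → Σ P λ z → x < z × z < y
  dense {x} {y} x<y =
    z , ≤∧≱⇒< (proj₂ (proj₁ at-x) ≤.refl) (λ z≤x → <⇒≱ x<y (proj₁ (proj₂ at-x) z≤x))
      , ≤∧≱⇒< (proj₂ (proj₂ at-y) ≤.refl) (λ y≤z → <⇒≱ x<y (proj₁ (proj₁ at-y) y≤z))
    where
    cut : Cut (_≤ x) (y ≤_)
    cut = record
      { down-closed = ≤.trans
      ; up-closed   = λ a≤b y≤a → ≤.trans y≤a a≤b
      ; D≤U         = λ a≤x y≤b → ≤.trans a≤x (≤.trans (proj₁ x<y) y≤b)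
      ; disjoint    = λ a≤x y≤a → <⇒≱ x<y (≤.trans y≤a a≤x) }
    extension = realise (x ∷ y ∷ []) cut
    z = proj₁ extension
    at-x = proj₂ extension (Any.here refl)
    at-y = proj₂ extension (Any.there (Any.here refl))

-- Comparing one point
-- of the chain with a point outside it fixes the direction.
module Orientation (𝕡 : RandomPO) where
  open RPO 𝕡
  open StrictOrder 𝕡
  private module ≤ = IsPartialOrder isPO

  Ascending : P → P → P → Set
  Ascending l m r = (l < m) × (m < r)

  orient-by-end : ∀ {l m r} → l < m → Betw l m r → m < r
  orient-by-end _   (inj₁ (_ , m<r)) = m<r
  orient-by-end l<m (inj₂ (_ , m<l)) = ⊥-elim (<⇒≱ l<m (proj₁ m<l))

  orient-below : ∀ {c l m r} → c < m → c ⊥ l → Betw l m r → Ascending l m r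
  orient-below _   _   (inj₁ ascending)  = ascending
  orient-below c<m c⊥l (inj₂ (_ , m<l)) = ⊥-elim (proj₁ c⊥l (≤.trans (proj₁ c<m) (proj₁ m<l)))

  orient-above : ∀ {c l m r} → m < c → c ⊥ r → Betw l m r → Ascending l m r
  orient-above _   _   (inj₁ ascending)  = ascending
  orient-above m<c c⊥r (inj₂ (r<m , _)) = ⊥-elim (proj₂ c⊥r (≤.trans (proj₁ r<m) (proj₁ m<c)))

ltAtoms : ∀ {n} → Term n → Term n → (Fin 7 → Term n) → List (Atom n)
ltAtoms x y ws =
  betw cu cv t ∷ betw a t b ∷ perp cv a ∷ betw q a p ∷ perp t p ∷
  betw y p w ∷ perp a y ∷ betw x y z ∷ perp p z ∷ []
  where
  t a b q p w z : Term _
  t = ws (# 0); a = ws (# 1); b = ws (# 2); q = ws (# 3); p = ws (# 4); w = ws (# 5); z = ws (# 6)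

lowAtoms : ∀ {n} → Term n → Term n → Term n → (Fin 18 → Term n) → List (Atom n)
lowAtoms x y z vs =
  perp y z ∷ betw a x b ∷ betw c x d ∷ perp y c ∷ perp z d ∷
  ltAtoms a y (λ i → vs (4 ↑ʳ (i ↑ˡ 7))) ++ ltAtoms b z (λ i → vs (4 ↑ʳ (7 ↑ʳ i)))
  where
  a b c d : Term _
  a = vs (# 0); b = vs (# 1); c = vs (# 2); d = vs (# 3)

φLt : PP 2
φLt = pp 7 (ltAtoms (var (# 0)) (var (# 1)) (λ i → var (2 ↑ʳ i)))

φLow : PP 3
φLow = pp 18 (lowAtoms (var (# 0)) (var (# 1)) (var (# 2)) (λ i → var (3 ↑ʳ i)))

module Definability (𝕡 : RandomPO) (u v : RandomPO.P 𝕡) (u<v : RPO._<_ 𝕡 u v) where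
  open RPO 𝕡
  open StrictOrder 𝕡
  open Extension 𝕡
  open Orientation 𝕡
  open PPSem 𝕡 u v
  open Rels 𝕡
  private module ≤ = IsPartialOrder isPO

  private
    here : ∀ {a : P} {as} → a ∈ a ∷ as
    here = Any.here refl
    there : ∀ {a b : P} {as} → a ∈ as → a ∈ b ∷ as
    there = Any.there

  record LtChain (x y t a b q p w z : P) : Set where
    field
      u-v-t : Betw u v t
      a-t-b : Betw a t b
      v⊥a   : v ⊥ a
      q-a-p : Betw q a p
      t⊥p   : t ⊥ p
      y-p-w : Betw y p w
      a⊥y   : a ⊥ y
      x-y-z : Betw x y z
      p⊥z   : p ⊥ z

  LtChainᵗ : P → P → (Fin 7 → P) → Set
  LtChainᵗ x y ws = LtChain x y (ws (# 0)) (ws (# 1)) (ws (# 2)) (ws (# 3)) (ws (# 4)) (ws (# 5)) (ws (# 6))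

  ltAtoms-meaning : ∀ {n} (ρ : Fin n → P) x y ws →
    All (satA ρ) (ltAtoms x y ws) ⇔ LtChainᵗ (evalT ρ x) (evalT ρ y) (evalT ρ ∘ ws)
  ltAtoms-meaning ρ x y ws =
    (λ { (s₁ ∷ s₂ ∷ s₃ ∷ s₄ ∷ s₅ ∷ s₆ ∷ s₇ ∷ s₈ ∷ s₉ ∷ []) → record
           { u-v-t = s₁ ; a-t-b = s₂ ; v⊥a = s₃ ; q-a-p = s₄ ; t⊥p = s₅
           ; y-p-w = s₆ ; a⊥y = s₇ ; x-y-z = s₈ ; p⊥z = s₉ } })
    , λ chain → let open LtChain chain in
        u-v-t ∷ a-t-b ∷ v⊥a ∷ q-a-p ∷ t⊥p ∷ y-p-w ∷ a⊥y ∷ x-y-z ∷ p⊥z ∷ []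

  ltChain-sound : ∀ {x y t a b q p w z} → LtChain x y t a b q p w z → x < y
  ltChain-sound chain = proj₁ (orient-above y<p p⊥z x-y-z)
    where
    open LtChain chain
    v<t = orient-by-end u<v u-v-t
    a<t = proj₁ (orient-below v<t v⊥a a-t-b)
    a<p = proj₂ (orient-above a<t t⊥p q-a-p)
    y<p = proj₁ (orient-below a<p a⊥y y-p-w)

  -- Completeness: for x < y the witnesses exist, chosen as generic points:
  -- t above v but not below y; a below t, incomparable to v and y;
  -- p above a and y, incomparable to t; z above y, incomparable to p;
  -- b, q, w merely complete the triples a t b, q a p, y p w.
  ltChain-complete : ∀ {x y} → x < y → Σ (Fin 7 → P) (LtChainᵗ x y)
  ltChain-complete {x} {y} x<y =
    (T.point ∷ᶠ A.point ∷ᶠ B.point ∷ᶠ Q.point ∷ᶠ Pt.point ∷ᶠ W.point ∷ᶠ Z.point ∷ᶠ []ᶠ) , record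
      { u-v-t = inj₁ (u<v , v<t)
      ; a-t-b = inj₁ (All.head A.below , All.head B.above)
      ; v⊥a   = A.not-above here , A.only-below here (<⇒≱ v<t ∷ [])
      ; q-a-p = inj₁ (All.head Q.below , a<p)
      ; t⊥p   = Pt.only-above here (<⇒≱ (All.head A.below) ∷ t≰y ∷ []) , Pt.not-below here
      ; y-p-w = inj₁ (y<p , All.head W.above)
      ; a⊥y   = A.only-below (there here) (t≰y ∷ []) , A.not-above (there here)
      ; x-y-z = inj₁ (x<y , All.head Z.above)
      ; p⊥z   = Z.only-above here (<⇒≱ y<p ∷ []) , Z.not-below here }
    where
    module T  = PointAbove (pointAbove (v ∷ []) (y ∷ []))
    v<t = All.head T.above
    t≰y = T.not-below here
    module A  = PointBelow (pointBelow (T.point ∷ []) (v ∷ y ∷ []))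
    module B  = PointAbove (pointAbove (T.point ∷ []) [])
    module Pt = PointAbove (pointAbove (A.point ∷ y ∷ []) (T.point ∷ []))
    a<p = All.head Pt.above
    y<p = All.head (All.tail Pt.above)
    module Q  = PointBelow (pointBelow (A.point ∷ []) [])
    module W  = PointAbove (pointAbove (Pt.point ∷ []) [])
    module Z  = PointAbove (pointAbove (y ∷ []) (Pt.point ∷ []))

  record LowFrame (x y z a b c d : P) : Set where
    field
      y⊥z   : y ⊥ z
      a-x-b : Betw a x b
      c-x-d : Betw c x d
      y⊥c   : y ⊥ c
      z⊥d   : z ⊥ d

  record LowWitness (x y z : P) : Set where
    field
      a b c d : P
      frame   : LowFrame x y z a b c d
      a<y     : a < y
      b<z     : b < z

  -- x is not below both y and z: the lower end of c x d would be below y or z.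
  not-below-both : ∀ {x y z c d} → Betw c x d → y ⊥ c → z ⊥ d → x ≤ y → x ≤ z → Empty
  not-below-both (inj₁ (c<x , _)) y⊥c _   x≤y _   = proj₂ y⊥c (≤.trans (proj₁ c<x) x≤y)
  not-below-both (inj₂ (d<x , _)) _   z⊥d _   x≤z = proj₂ z⊥d (≤.trans (proj₁ d<x) x≤z)

  lowWitness-sound : ∀ {x y z} → LowWitness x y z → Low x y z
  lowWitness-sound w with LowFrame.a-x-b (LowWitness.frame w)
  ... | inj₁ (_ , x<b) = inj₂ (x<z , (y≰x , x≰y) , y⊥z)
    where
    open LowWitness w
    open LowFrame frame
    x<z = <-trans x<b b<z
    y≰x = λ y≤x → proj₁ y⊥z (≤.trans y≤x (proj₁ x<z))
    x≰y = λ x≤y → not-below-both c-x-d y⊥c z⊥d x≤y (proj₁ x<z)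
  ... | inj₂ (_ , x<a) = inj₁ (x<y , (z≰x , x≰z) , (proj₂ y⊥z , proj₁ y⊥z))
    where
    open LowWitness w
    open LowFrame frame
    x<y = <-trans x<a a<y
    z≰x = λ z≤x → proj₂ y⊥z (≤.trans z≤x (proj₁ x<y))
    x≰z = λ x≤z → not-below-both c-x-d y⊥c z⊥d (proj₁ x<y) x≤z

  lowWitness-complete : ∀ {x y z} → Low x y z → LowWitness x y z
  lowWitness-complete {x} {y} {z} (inj₁ (x<y , z⊥x , z⊥y)) = record
    { a = proj₁ A ; b = B.point ; c = C.point ; d = D.point
    ; frame = record
      { y⊥z   = proj₂ z⊥y , proj₁ z⊥y
      ; a-x-b = inj₂ (All.head B.below , proj₁ (proj₂ A))
      ; c-x-d = inj₂ (All.head D.below , All.head C.above)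
      ; y⊥c   = C.only-above here (<⇒≱ x<y ∷ []) , C.not-below here
      ; z⊥d   = D.not-above here , D.only-below here (proj₂ z⊥x ∷ []) }
    ; a<y = proj₂ (proj₂ A)
    ; b<z = All.head (All.tail B.below) }
    where
    A = dense x<y
    module B = PointBelow (pointBelow (x ∷ z ∷ []) [])
    module C = PointAbove (pointAbove (x ∷ []) (y ∷ []))
    module D = PointBelow (pointBelow (x ∷ []) (z ∷ []))
  lowWitness-complete {x} {y} {z} (inj₂ (x<z , y⊥x , y⊥z)) = record
    { a = A.point ; b = proj₁ B ; c = C.point ; d = D.point
    ; frame = record
      { y⊥z   = y⊥z
      ; a-x-b = inj₁ (All.head A.below , proj₁ (proj₂ B))
      ; c-x-d = inj₁ (All.head C.below , All.head D.above)
      ; y⊥c   = C.not-above here , C.only-below here (proj₂ y⊥x ∷ [])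
      ; z⊥d   = D.only-above here (<⇒≱ x<z ∷ []) , D.not-below here }
    ; a<y = All.head (All.tail A.below)
    ; b<z = proj₂ (proj₂ B) }
    where
    module A = PointBelow (pointBelow (x ∷ y ∷ []) [])
    B = dense x<z
    module C = PointBelow (pointBelow (x ∷ []) (y ∷ []))
    module D = PointAbove (pointAbove (x ∷ []) (z ∷ []))

  LowChainᵗ : P → P → P → (Fin 18 → P) → Set
  LowChainᵗ x y z vs =
    LowFrame x y z (vs (# 0)) (vs (# 1)) (vs (# 2)) (vs (# 3)) ×
    LtChainᵗ (vs (# 0)) y (λ i → vs (4 ↑ʳ (i ↑ˡ 7))) ×
    LtChainᵗ (vs (# 1)) z (λ i → vs (4 ↑ʳ (7 ↑ʳ i)))

  lowAtoms-meaning : ∀ {n} (ρ : Fin n → P) x y z vs →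
    All (satA ρ) (lowAtoms x y z vs) ⇔ LowChainᵗ (evalT ρ x) (evalT ρ y) (evalT ρ z) (evalT ρ ∘ vs)
  lowAtoms-meaning ρ x y z vs =
    (λ { (s₁ ∷ s₂ ∷ s₃ ∷ s₄ ∷ s₅ ∷ chains) →
         let (chain₁ , chain₂) = ++⁻ (ltAtoms (vs (# 0)) y ws₁) chains in
         record { y⊥z = s₁ ; a-x-b = s₂ ; c-x-d = s₃ ; y⊥c = s₄ ; z⊥d = s₅ }
         , proj₁ (ltAtoms-meaning ρ _ _ ws₁) chain₁ , proj₁ (ltAtoms-meaning ρ _ _ ws₂) chain₂ })
    , λ (frame , chain₁ , chain₂) → let open LowFrame frame in
        y⊥z ∷ a-x-b ∷ c-x-d ∷ y⊥c ∷ z⊥d ∷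
        ++⁺ (proj₂ (ltAtoms-meaning ρ _ _ ws₁) chain₁) (proj₂ (ltAtoms-meaning ρ _ _ ws₂) chain₂)
    where
    ws₁ ws₂ : Fin 7 → Term _
    ws₁ i = vs (4 ↑ʳ (i ↑ˡ 7))
    ws₂ i = vs (4 ↑ʳ (7 ↑ʳ i))

  lowChain-sound : ∀ {x y z vs} → LowChainᵗ x y z vs → Low x y z
  lowChain-sound (frame , chain₁ , chain₂) = lowWitness-sound record
    { frame = frame ; a<y = ltChain-sound chain₁ ; b<z = ltChain-sound chain₂ }

  lowChain-complete : ∀ {x y z} → Low x y z → Σ (Fin 18 → P) (LowChainᵗ x y z)
  lowChain-complete low =
    (a ∷ᶠ b ∷ᶠ c ∷ᶠ d ∷ᶠ (proj₁ chain₁ ++ᶠ proj₁ chain₂)) , frame , proj₂ chain₁ , proj₂ chain₂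
    where
    open LowWitness (lowWitness-complete low)
    chain₁ = ltChain-complete a<y
    chain₂ = ltChain-complete b<z

  ltDefinable : PPDefinable LtRel
  ltDefinable = φLt , λ x →
      (λ x<y → let (ws , chain) = ltChain-complete x<y in ws , proj₂ (meaning x ws) chain)
    , (λ (ws , sat) → ltChain-sound (proj₁ (meaning x ws) sat))
    where
    meaning = λ x ws → ltAtoms-meaning (x ++ᶠ ws) (var (# 0)) (var (# 1)) (λ i → var (2 ↑ʳ i))

  lowDefinable : PPDefinable LowRel
  lowDefinable = φLow , λ x →
      (λ low → let (vs , chain) = lowChain-complete low in vs , proj₂ (meaning x vs) chain)
    , (λ (vs , sat) → lowChain-sound {vs = vs} (proj₁ (meaning x vs) sat))
    where
    meaning = λ x vs → lowAtoms-meaning (x ++ᶠ vs) (var (# 0)) (var (# 1)) (var (# 2)) (λ i → var (3 ↑ʳ i))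

mainTheorem18 : (𝕡 : RandomPO) (u v : RandomPO.P 𝕡) → RPO._<_ 𝕡 u v →
    PPSem.PPDefinable 𝕡 u v (Rels.LtRel 𝕡) × PPSem.PPDefinable 𝕡 u v (Rels.LowRel 𝕡)
mainTheorem18 𝕡 u v u<v = ltDefinable , lowDefinable
  where open Definability 𝕡 u v u<v
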